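{- Let $g(x)\in\mathbb{Z}[[x]]$ with $g(0)=1$, and let $F(x)=\frac{1}{(1-2x)\,g\left(\frac{x}{1-x}\right)}$. Then the central transform of $g$ (defined in the context) satisfies $$\mathbf{C}(g(x))=F\big(xc(x)\big),$$ where $c(x)=\frac{1-\sqrt{1-4x}}{2x}$; that is, $\mathbf{C}(g(x))$ is obtained by applying the Riordan array $(1,xc(x))$ (the matrix with $(n,k)$ entry $[x^n](xc(x))^k$) to the coefficient sequence of $F$.
   Context: For a power series $g(x)\in\mathbb{Z}[[x]]$ with $g(0)=1$, let $t_{n,k}=[x^n]\,\frac{1}{1-x}\,\frac{1}{g\left(\frac{x}{1-x}\right)}\left(\frac{x}{1-x}\right)^k$ for $n,k\ge0$, where $[x^n]$ extracts the coefficient of $x^n$. The central transform $\mathbf{C}(g(x))$ is the power series $\sum_{n\ge0}b_nx^n$ with $b_n=t_{2n,n}$. -}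

module Defs where

open import Data.Nat using (ℕ; zero; suc; _∸_; _/_) renaming (_*_ to _*ℕ_; _+_ to _+ℕ_)
open import Data.Nat.Combinatorics using (_C_)
open import Data.Integer using (ℤ; +_; _+_; _*_; -_; _-_)
open import Data.Vec using (Vec; []; _∷_; head)

Series : Set
Series = ℕ → ℤ

sum< : ℕ → (ℕ → ℤ) → ℤ
sum< zero    f = + 0
sum< (suc n) f = sum< n f + f n

oneS : Series
oneS zero    = + 1
oneS (suc _) = + 0

X : Series
X 1 = + 1
X _ = + 0

_⊕_ : Series → Series → Series
(f ⊕ g) n = f n + g n

scale : ℤ → Series → Series
scale a f n = a * f n

mul : Series → Series → Series
mul f g n = sum< (suc n) (λ i → f i * g (n ∸ i))

pow : Series → ℕ → Series
pow f zero    = oneS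
pow f (suc k) = mul f (pow f k)

-- total lookup (0 outside the vector)
nth : ∀ {m} → Vec ℤ m → ℕ → ℤ
nth []       _       = + 0
nth (a ∷ v)  zero    = a
nth (a ∷ v)  (suc j) = nth v j

-- invVec f n = [inv_n, inv_{n-1}, ..., inv_0], the first coefficients of 1/f,
-- computed by the usual recursion inv_0 = 1, inv_n = - Σ_{i=1}^{n} f_i inv_{n-i}
-- (valid for f with f 0 = 1).
invVec : Series → (n : ℕ) → Vec ℤ (suc n)
invVec f zero    = + 1 ∷ []
invVec f (suc n) = (- sum< (suc n) (λ j → f (suc j) * nth v j)) ∷ v
  where v = invVec f n

inv : Series → Series
inv f n = head (invVec f n)

-- composition f(s(x)) = Σ_k f_k s(x)^k, for s with s 0 = 0
comp : Series → Series → Series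
comp f s n = sum< (suc n) (λ k → f k * pow s k n)

geom : Series
geom = inv (oneS ⊕ scale (- + 1) X)

xOver1mx : Series
xOver1mx = mul X geom

tnk : Series → ℕ → ℕ → ℤ
tnk g n k = mul geom (mul (inv (comp g xOver1mx)) (pow xOver1mx k)) n

centralTransform : Series → Series
centralTransform g n = tnk g (2 *ℕ n) n

Fser : Series → Series
Fser g = inv (mul (oneS ⊕ scale (- + 2) X) (comp g xOver1mx))

-- c(x) = (1 - sqrt(1-4x))/(2x) = Σ_n Catalan(n) x^n, Catalan(n) = binom(2n,n)/(n+1)
catalanS : Series
catalanS n = + (((2 *ℕ n) C n) / suc n)

xc : Series
xc = mul X catalanS

-- Write H = 1/g(x/(1-x)). The columns (x/(1-x))^k/(1-x) of Pascal's triangle turn the central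
-- transform into b_n = Σ_{m≤n} H_m C(2n-m, n), while F = H/(1-2x) gives
-- F(xc) = Σ_m H_m [x^n] (xc)^m/(1-2xc). The central binomial series B = Σ C(2n,n) x^n satisfies
-- B (1 - 2xc) = 1, and xc satisfies (xc)² = xc - x; both follow by comparing derivatives,
-- since (n+1) Catalan(n) = C(2n,n). The second identity gives a Pascal-type recurrence for the
-- coefficients of B (xc)^m, which identifies [x^n] B (xc)^m with C(2n-m, n).
module Submission where

open import Relation.Binary.PropositionalEquality using (_≡_)
open import Data.Nat using (ℕ)
open import Data.Integer using (+_)
open import Defs

open import Relation.Binary.PropositionalEquality
  using (refl; sym; trans; cong; cong₂; subst; subst₂; _≗_; _→-setoid_; module ≡-Reasoning)
import Relation.Binary.Reasoning.Setoid as SetoidReasoning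
open import Data.Nat using (zero; suc; _∸_; _/_; _≤_; _<_; z≤n; s≤s) renaming (_+_ to _+ℕ_; _*_ to _*ℕ_)
import Data.Nat.Properties as ℕ
open import Data.Nat.DivMod using (m*n/n≡m)
open import Data.Nat.Combinatorics using (_C_; nCk+nC[k+1]≡[n+1]C[k+1]; nCk≡nC[n∸k]; nC1≡n; k>n⇒nCk≡0)
import Data.Nat.Tactic.RingSolver as ℕ-Solver
open import Data.Integer using (ℤ; _+_; _*_; -_)
import Data.Integer.Properties as ℤ
open import Data.Integer.Tactic.RingSolver using (solve-∀)

module ≗-Reasoning = SetoidReasoning (ℕ →-setoid ℤ)

-- Finite sums

sum<-cong : ∀ n {f g : ℕ → ℤ} → (∀ {i} → i < n → f i ≡ g i) → sum< n f ≡ sum< n g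
sum<-cong zero    eq = refl
sum<-cong (suc n) eq = cong₂ _+_ (sum<-cong n (λ i<n → eq (ℕ.m<n⇒m<1+n i<n))) (eq (ℕ.n<1+n n))

sum<-ext : ∀ n {f g : ℕ → ℤ} → f ≗ g → sum< n f ≡ sum< n g
sum<-ext n eq = sum<-cong n (λ {i} _ → eq i)

sum<-zero : ∀ n {f : ℕ → ℤ} → (∀ {i} → i < n → f i ≡ + 0) → sum< n f ≡ + 0
sum<-zero zero    eq = refl
sum<-zero (suc n) eq = cong₂ _+_ (sum<-zero n (λ i<n → eq (ℕ.m<n⇒m<1+n i<n))) (eq (ℕ.n<1+n n))

sum<-distrib-+ : ∀ n (f g : ℕ → ℤ) → sum< n (λ i → f i + g i) ≡ sum< n f + sum< n g
sum<-distrib-+ zero    f g = refl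
sum<-distrib-+ (suc n) f g =
  trans (cong (_+ (f n + g n)) (sum<-distrib-+ n f g)) (interchange (sum< n f) (sum< n g) (f n) (g n))
  where
  interchange : ∀ (a b c d : ℤ) → (a + b) + (c + d) ≡ (a + c) + (b + d)
  interchange = solve-∀

*-distribˡ-sum< : ∀ n a (f : ℕ → ℤ) → a * sum< n f ≡ sum< n (λ i → a * f i)
*-distribˡ-sum< zero    a f = ℤ.*-zeroʳ a
*-distribˡ-sum< (suc n) a f =
  trans (ℤ.*-distribˡ-+ a (sum< n f) (f n)) (cong (_+ (a * f n)) (*-distribˡ-sum< n a f))

*-distribʳ-sum< : ∀ n a (f : ℕ → ℤ) → sum< n f * a ≡ sum< n (λ i → f i * a)
*-distribʳ-sum< n a f =
  trans (ℤ.*-comm (sum< n f) a) (trans (*-distribˡ-sum< n a f) (sum<-ext n (λ i → ℤ.*-comm a (f i))))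

sum<-suc-head : ∀ n (f : ℕ → ℤ) → sum< (suc n) f ≡ f 0 + sum< n (λ i → f (suc i))
sum<-suc-head zero    f = trans (ℤ.+-identityˡ (f 0)) (sym (ℤ.+-identityʳ (f 0)))
sum<-suc-head (suc n) f = trans (cong (_+ f (suc n)) (sum<-suc-head n f)) (ℤ.+-assoc (f 0) _ _)

sum<-+ℕ : ∀ m n (f : ℕ → ℤ) → sum< (m +ℕ n) f ≡ sum< m f + sum< n (λ i → f (m +ℕ i))
sum<-+ℕ m zero    f rewrite ℕ.+-identityʳ m = sym (ℤ.+-identityʳ _)
sum<-+ℕ m (suc n) f rewrite ℕ.+-suc m n =
  trans (cong (_+ f (m +ℕ n)) (sum<-+ℕ m n f)) (ℤ.+-assoc (sum< m f) _ _)

sum<-reverse : ∀ n (f : ℕ → ℤ) → sum< n f ≡ sum< n (λ i → f (n ∸ suc i))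
sum<-reverse zero    f = refl
sum<-reverse (suc n) f = begin
  sum< n f + f n                            ≡⟨ ℤ.+-comm (sum< n f) (f n) ⟩
  f n + sum< n f                            ≡⟨ cong (λ z → f n + z) (sum<-reverse n f) ⟩
  f (n ∸ 0) + sum< n (λ i → f (n ∸ suc i))  ≡⟨ sum<-suc-head n (λ i → f (n ∸ i)) ⟨
  sum< (suc n) (λ i → f (n ∸ i))            ∎
  where open ≡-Reasoning

sum<-triangle : ∀ N (F : ℕ → ℕ → ℤ) →
  sum< N (λ k → sum< (suc k) (λ m → F m k)) ≡ sum< N (λ m → sum< (N ∸ m) (λ j → F m (m +ℕ j)))
sum<-triangle zero    F = refl
sum<-triangle (suc N) F = begin
  sum< N (λ k → sum< (suc k) (λ m → F m k)) + sum< (suc N) (λ m → F m N)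
    ≡⟨ cong (_+ sum< (suc N) (λ m → F m N)) (sum<-triangle N F) ⟩
  sum< N row + sum< (suc N) (λ m → F m N)
    ≡⟨ cong (_+ sum< (suc N) (λ m → F m N)) (ℤ.+-identityʳ (sum< N row)) ⟨
  (sum< N row + + 0) + sum< (suc N) (λ m → F m N)
    ≡⟨ cong (λ z → (sum< N row + sum< z (λ j → F N (N +ℕ j))) + sum< (suc N) (λ m → F m N)) (ℕ.n∸n≡0 N) ⟨
  sum< (suc N) row + sum< (suc N) (λ m → F m N)
    ≡⟨ sum<-distrib-+ (suc N) row (λ m → F m N) ⟨
  sum< (suc N) (λ m → row m + F m N)
    ≡⟨ sum<-cong (suc N) extend-row ⟩
  sum< (suc N) (λ m → sum< (suc N ∸ m) (λ j → F m (m +ℕ j))) ∎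
  where
  open ≡-Reasoning
  row : ℕ → ℤ
  row m = sum< (N ∸ m) (λ j → F m (m +ℕ j))
  extend-row : ∀ {m} → m < suc N → row m + F m N ≡ sum< (suc N ∸ m) (λ j → F m (m +ℕ j))
  extend-row {m} (s≤s m≤N) rewrite ℕ.+-∸-assoc 1 m≤N =
    cong (λ z → row m + F m z) (sym (ℕ.m+[n∸m]≡n m≤N))

-- The ring of power series

mul-cong : ∀ {f f′ g g′} → f ≗ f′ → g ≗ g′ → mul f g ≗ mul f′ g′
mul-cong f≗f′ g≗g′ n = sum<-ext (suc n) (λ i → cong₂ _*_ (f≗f′ i) (g≗g′ (n ∸ i)))

mul-congˡ : ∀ {f f′} g → f ≗ f′ → mul f g ≗ mul f′ g
mul-congˡ {f} {f′} g f≗f′ = mul-cong {f} {f′} {g} {g} f≗f′ (λ _ → refl)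

mul-congʳ : ∀ f {g g′} → g ≗ g′ → mul f g ≗ mul f g′
mul-congʳ f {g} {g′} g≗g′ = mul-cong {f} {f} {g} {g′} (λ _ → refl) g≗g′

mul-comm : ∀ f g → mul f g ≗ mul g f
mul-comm f g n = begin
  sum< (suc n) (λ i → f i * g (n ∸ i))                ≡⟨ sum<-reverse (suc n) _ ⟩
  sum< (suc n) (λ i → f (n ∸ i) * g (n ∸ (n ∸ i)))    ≡⟨ sum<-cong (suc n) swap ⟩
  sum< (suc n) (λ i → g i * f (n ∸ i))                ∎
  where
  open ≡-Reasoning
  swap : ∀ {i} → i < suc n → f (n ∸ i) * g (n ∸ (n ∸ i)) ≡ g i * f (n ∸ i)
  swap {i} (s≤s i≤n) rewrite ℕ.m∸[m∸n]≡n i≤n = ℤ.*-comm (f (n ∸ i)) (g i)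

mul-identityˡ : ∀ f → mul oneS f ≗ f
mul-identityˡ f n = begin
  sum< (suc n) (λ i → oneS i * f (n ∸ i))
    ≡⟨ sum<-suc-head n _ ⟩
  + 1 * f n + sum< n (λ i → + 0 * f (n ∸ suc i))
    ≡⟨ cong₂ _+_ (ℤ.*-identityˡ (f n)) (sum<-zero n (λ {i} _ → ℤ.*-zeroˡ (f (n ∸ suc i)))) ⟩
  f n + + 0
    ≡⟨ ℤ.+-identityʳ (f n) ⟩
  f n ∎
  where open ≡-Reasoning

mul-identityʳ : ∀ f → mul f oneS ≗ f
mul-identityʳ f n = trans (mul-comm f oneS n) (mul-identityˡ f n)

mul-assoc : ∀ f g h → mul (mul f g) h ≗ mul f (mul g h)
mul-assoc f g h n = begin
  sum< (suc n) (λ k → sum< (suc k) (λ m → f m * g (k ∸ m)) * h (n ∸ k))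
    ≡⟨ sum<-ext (suc n) (λ k → *-distribʳ-sum< (suc k) (h (n ∸ k)) _) ⟩
  sum< (suc n) (λ k → sum< (suc k) (λ m → f m * g (k ∸ m) * h (n ∸ k)))
    ≡⟨ sum<-triangle (suc n) (λ m k → f m * g (k ∸ m) * h (n ∸ k)) ⟩
  sum< (suc n) (λ m → sum< (suc n ∸ m) (λ j → f m * g ((m +ℕ j) ∸ m) * h (n ∸ (m +ℕ j))))
    ≡⟨ sum<-cong (suc n) inner ⟩
  sum< (suc n) (λ m → f m * sum< (suc (n ∸ m)) (λ j → g j * h ((n ∸ m) ∸ j))) ∎
  where
  open ≡-Reasoning
  inner : ∀ {m} → m < suc n →
    sum< (suc n ∸ m) (λ j → f m * g ((m +ℕ j) ∸ m) * h (n ∸ (m +ℕ j)))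
      ≡ f m * sum< (suc (n ∸ m)) (λ j → g j * h ((n ∸ m) ∸ j))
  inner {m} (s≤s m≤n) rewrite ℕ.+-∸-assoc 1 m≤n = begin
    sum< (suc (n ∸ m)) (λ j → f m * g ((m +ℕ j) ∸ m) * h (n ∸ (m +ℕ j)))
      ≡⟨ sum<-ext (suc (n ∸ m)) (λ j → trans (ℤ.*-assoc (f m) _ _)
           (cong₂ (λ a b → f m * (g a * h b)) (ℕ.m+n∸m≡n m j) (sym (ℕ.∸-+-assoc n m j)))) ⟩
    sum< (suc (n ∸ m)) (λ j → f m * (g j * h ((n ∸ m) ∸ j)))
      ≡⟨ *-distribˡ-sum< (suc (n ∸ m)) (f m) _ ⟨
    f m * sum< (suc (n ∸ m)) (λ j → g j * h ((n ∸ m) ∸ j)) ∎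

mul-distribˡ-⊕ : ∀ f g h → mul f (g ⊕ h) ≗ (mul f g ⊕ mul f h)
mul-distribˡ-⊕ f g h n =
  trans (sum<-ext (suc n) (λ i → ℤ.*-distribˡ-+ (f i) (g (n ∸ i)) (h (n ∸ i)))) (sum<-distrib-+ (suc n) _ _)

mul-distribʳ-⊕ : ∀ f g h → mul (g ⊕ h) f ≗ (mul g f ⊕ mul h f)
mul-distribʳ-⊕ f g h n =
  trans (mul-comm (g ⊕ h) f n)
    (trans (mul-distribˡ-⊕ f g h n) (cong₂ _+_ (mul-comm f g n) (mul-comm f h n)))

mul-scaleʳ : ∀ f a g → mul f (scale a g) ≗ scale a (mul f g)
mul-scaleʳ f a g n =
  trans (sum<-ext (suc n) (λ i → x[ay]≡a[xy] (f i) a (g (n ∸ i)))) (sym (*-distribˡ-sum< (suc n) a _))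
  where
  x[ay]≡a[xy] : ∀ (x a y : ℤ) → x * (a * y) ≡ a * (x * y)
  x[ay]≡a[xy] = solve-∀

mul-scaleˡ : ∀ a g f → mul (scale a g) f ≗ scale a (mul g f)
mul-scaleˡ a g f n =
  trans (mul-comm (scale a g) f n) (trans (mul-scaleʳ f a g n) (cong (a *_) (mul-comm f g n)))

mul-constant : ∀ f g → mul f g 0 ≡ f 0 * g 0
mul-constant f g = ℤ.+-identityˡ (f 0 * g 0)

mul-interchange : ∀ a b c d → mul (mul a b) (mul c d) ≗ mul (mul a c) (mul b d)
mul-interchange a b c d = begin
  mul (mul a b) (mul c d)  ≈⟨ mul-assoc a b (mul c d) ⟩
  mul a (mul b (mul c d))  ≈⟨ mul-congʳ a (mul-assoc b c d) ⟨
  mul a (mul (mul b c) d)  ≈⟨ mul-congʳ a (mul-congˡ d (mul-comm b c)) ⟩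
  mul a (mul (mul c b) d)  ≈⟨ mul-congʳ a (mul-assoc c b d) ⟩
  mul a (mul c (mul b d))  ≈⟨ mul-assoc a c (mul b d) ⟨
  mul (mul a c) (mul b d)  ∎
  where open ≗-Reasoning

shift : Series → Series
shift f zero    = + 0
shift f (suc n) = f n

mul-Xˡ : ∀ f → mul X f ≗ shift f
mul-Xˡ f zero    = ℤ.+-identityˡ (+ 0 * f 0)
mul-Xˡ f (suc n) = begin
  sum< (suc (suc n)) (λ i → X i * f (suc n ∸ i))
    ≡⟨ sum<-suc-head (suc n) _ ⟩
  + 0 * f (suc n) + sum< (suc n) (λ i → X (suc i) * f (n ∸ i))
    ≡⟨ cong (λ z → + 0 * f (suc n) + z) (sum<-suc-head n _) ⟩
  + 0 * f (suc n) + (+ 1 * f n + sum< n (λ i → + 0 * f (n ∸ suc i)))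
    ≡⟨ cong₂ (λ a b → a + (b + sum< n (λ i → + 0 * f (n ∸ suc i))))
             (ℤ.*-zeroˡ (f (suc n))) (ℤ.*-identityˡ (f n)) ⟩
  + 0 + (f n + sum< n (λ i → + 0 * f (n ∸ suc i)))
    ≡⟨ ℤ.+-identityˡ _ ⟩
  f n + sum< n (λ i → + 0 * f (n ∸ suc i))
    ≡⟨ cong (λ z → f n + z) (sum<-zero n (λ {i} _ → ℤ.*-zeroˡ (f (n ∸ suc i)))) ⟩
  f n + + 0
    ≡⟨ ℤ.+-identityʳ (f n) ⟩
  f n ∎
  where open ≡-Reasoning

1+cX : ℤ → Series
1+cX c = oneS ⊕ scale c X

mul-1+cX : ∀ c f → mul (1+cX c) f ≗ (f ⊕ scale c (shift f))
mul-1+cX c f n = begin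
  mul (1+cX c) f n                    ≡⟨ mul-distribʳ-⊕ f oneS (scale c X) n ⟩
  mul oneS f n + mul (scale c X) f n  ≡⟨ cong₂ _+_ (mul-identityˡ f n) (mul-scaleˡ c X f n) ⟩
  f n + c * mul X f n                 ≡⟨ cong (λ z → f n + c * z) (mul-Xˡ f n) ⟩
  f n + c * shift f n                 ∎
  where open ≡-Reasoning

nth-invVec : ∀ f n j → j ≤ n → nth (invVec f n) j ≡ inv f (n ∸ j)
nth-invVec f zero    zero    _         = refl
nth-invVec f (suc n) zero    _         = refl
nth-invVec f (suc n) (suc j) (s≤s j≤n) = nth-invVec f n j j≤n

inv-suc : ∀ f n → inv f (suc n) ≡ - sum< (suc n) (λ j → f (suc j) * inv f (n ∸ j))
inv-suc f n = cong -_ (sum<-cong (suc n) (λ {j} j<1+n → cong (f (suc j) *_) (nth-invVec f n j (ℕ.≤-pred j<1+n))))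

inverseʳ : ∀ f → f 0 ≡ + 1 → mul f (inv f) ≗ oneS
inverseʳ f f₀≡1 zero    rewrite f₀≡1 = refl
inverseʳ f f₀≡1 (suc n) = begin
  sum< (suc (suc n)) (λ i → f i * inv f (suc n ∸ i))  ≡⟨ sum<-suc-head (suc n) _ ⟩
  f 0 * inv f (suc n) + S                             ≡⟨ cong₂ (λ a b → a * b + S) f₀≡1 (inv-suc f n) ⟩
  + 1 * (- S) + S                                     ≡⟨ cancel S ⟩
  + 0                                                 ∎
  where
  open ≡-Reasoning
  S = sum< (suc n) (λ j → f (suc j) * inv f (n ∸ j))
  cancel : ∀ (s : ℤ) → + 1 * (- s) + s ≡ + 0
  cancel = solve-∀

inverseʳ-unique : ∀ f h → f 0 ≡ + 1 → mul f h ≗ oneS → h ≗ inv f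
inverseʳ-unique f h f₀≡1 fh≗1 = begin
  h                      ≈⟨ mul-identityʳ h ⟨
  mul h oneS             ≈⟨ mul-congʳ h (inverseʳ f f₀≡1) ⟨
  mul h (mul f (inv f))  ≈⟨ mul-assoc h f (inv f) ⟨
  mul (mul h f) (inv f)  ≈⟨ mul-congˡ (inv f) (λ n → trans (mul-comm h f n) (fh≗1 n)) ⟩
  mul oneS (inv f)       ≈⟨ mul-identityˡ (inv f) ⟩
  inv f                  ∎
  where open ≗-Reasoning

inv-mul : ∀ f g → f 0 ≡ + 1 → g 0 ≡ + 1 → inv (mul f g) ≗ mul (inv f) (inv g)
inv-mul f g f₀≡1 g₀≡1 n = sym (inverseʳ-unique (mul f g) (mul (inv f) (inv g)) fg₀≡1 product n)
  where
  fg₀≡1 : mul f g 0 ≡ + 1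
  fg₀≡1 rewrite mul-constant f g | f₀≡1 | g₀≡1 = refl
  product : mul (mul f g) (mul (inv f) (inv g)) ≗ oneS
  product = begin
    mul (mul f g) (mul (inv f) (inv g))  ≈⟨ mul-interchange f g (inv f) (inv g) ⟩
    mul (mul f (inv f)) (mul g (inv g))  ≈⟨ mul-cong (inverseʳ f f₀≡1) (inverseʳ g g₀≡1) ⟩
    mul oneS oneS                        ≈⟨ mul-identityˡ oneS ⟩
    oneS                                 ∎
    where open ≗-Reasoning

ones : Series
ones _ = + 1

geom≗ones : geom ≗ ones
geom≗ones n = sym (inverseʳ-unique _ ones refl (λ k → trans (mul-1+cX (- + 1) ones k) (telescope k)) n)
  where
  telescope : (ones ⊕ scale (- + 1) (shift ones)) ≗ oneS
  telescope zero    = refl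
  telescope (suc n) = refl

pow2 : Series
pow2 zero    = + 1
pow2 (suc k) = + 2 * pow2 k

inv[1-2X]≗pow2 : inv (1+cX (- + 2)) ≗ pow2
inv[1-2X]≗pow2 n = sym (inverseʳ-unique _ pow2 refl (λ k → trans (mul-1+cX (- + 2) pow2 k) (telescope k)) n)
  where
  cancel : ∀ (x : ℤ) → + 2 * x + (- + 2) * x ≡ + 0
  cancel = solve-∀
  telescope : (pow2 ⊕ scale (- + 2) (shift pow2)) ≗ oneS
  telescope zero    = refl
  telescope (suc n) = cancel (pow2 n)

mul-geom : ∀ f n → mul geom f n ≡ sum< (suc n) f
mul-geom f n =
  trans (mul-comm geom f n)
    (sum<-ext (suc n) (λ i → trans (cong (f i *_) (geom≗ones (n ∸ i))) (ℤ.*-identityʳ (f i))))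

-- Pascal's triangle and the central transform

hockey-stick : ∀ j k → sum< (suc j) (λ i → + (i C k)) ≡ + (suc j C suc k)
hockey-stick zero    k = begin
  + 0 + + (0 C k)              ≡⟨ ℤ.+-identityˡ _ ⟩
  + (0 C k)                    ≡⟨ cong +_ (ℕ.+-identityʳ (0 C k)) ⟨
  + ((0 C k) +ℕ 0)             ≡⟨ cong (λ z → + ((0 C k) +ℕ z)) (k>n⇒nCk≡0 (s≤s (z≤n {k}))) ⟨
  + ((0 C k) +ℕ (0 C suc k))   ≡⟨ cong +_ (nCk+nC[k+1]≡[n+1]C[k+1] 0 k) ⟩
  + (1 C suc k)                ∎
  where open ≡-Reasoning
hockey-stick (suc j) k = begin
  sum< (suc j) (λ i → + (i C k)) + + (suc j C k)  ≡⟨ cong (_+ + (suc j C k)) (hockey-stick j k) ⟩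
  + (suc j C suc k) + + (suc j C k)               ≡⟨ ℤ.pos-+ (suc j C suc k) (suc j C k) ⟨
  + ((suc j C suc k) +ℕ (suc j C k))              ≡⟨ cong +_ (ℕ.+-comm (suc j C suc k) (suc j C k)) ⟩
  + ((suc j C k) +ℕ (suc j C suc k))              ≡⟨ cong +_ (nCk+nC[k+1]≡[n+1]C[k+1] (suc j) k) ⟩
  + (suc (suc j) C suc k)                         ∎
  where open ≡-Reasoning

geom*xOver1mx^suc : ∀ k → mul geom (pow xOver1mx (suc k)) ≗ shift (mul geom (mul geom (pow xOver1mx k)))
geom*xOver1mx^suc k = begin
  mul geom (mul (mul X geom) P)    ≈⟨ mul-congʳ geom (mul-assoc X geom P) ⟩
  mul geom (mul X (mul geom P))    ≈⟨ mul-assoc geom X (mul geom P) ⟨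
  mul (mul geom X) (mul geom P)    ≈⟨ mul-congˡ (mul geom P) (mul-comm geom X) ⟩
  mul (mul X geom) (mul geom P)    ≈⟨ mul-assoc X geom (mul geom P) ⟩
  mul X (mul geom (mul geom P))    ≈⟨ mul-Xˡ (mul geom (mul geom P)) ⟩
  shift (mul geom (mul geom P))    ∎
  where
  open ≗-Reasoning
  P = pow xOver1mx k

geom*xOver1mx^k : ∀ k j → mul geom (pow xOver1mx k) j ≡ + (j C k)
geom*xOver1mx^k zero    j       = trans (mul-identityʳ geom j) (geom≗ones j)
geom*xOver1mx^k (suc k) zero    =
  trans (geom*xOver1mx^suc k 0) (cong +_ (sym (k>n⇒nCk≡0 (s≤s (z≤n {k})))))
geom*xOver1mx^k (suc k) (suc j) = begin
  mul geom (pow xOver1mx (suc k)) (suc j)     ≡⟨ geom*xOver1mx^suc k (suc j) ⟩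
  mul geom (mul geom (pow xOver1mx k)) j      ≡⟨ mul-geom _ j ⟩
  sum< (suc j) (mul geom (pow xOver1mx k))    ≡⟨ sum<-ext (suc j) (geom*xOver1mx^k k) ⟩
  sum< (suc j) (λ i → + (i C k))              ≡⟨ hockey-stick j k ⟩
  + (suc j C suc k)                           ∎
  where open ≡-Reasoning

tnk≡sum : ∀ g N k → tnk g N k ≡ sum< (suc N) (λ m → inv (comp g xOver1mx) m * + ((N ∸ m) C k))
tnk≡sum g N k = begin
  mul geom (mul H P) N  ≡⟨ mul-assoc geom H P N ⟨
  mul (mul geom H) P N  ≡⟨ mul-congˡ P (mul-comm geom H) N ⟩
  mul (mul H geom) P N  ≡⟨ mul-assoc H geom P N ⟩
  mul H (mul geom P) N  ≡⟨ sum<-ext (suc N) (λ m → cong (H m *_) (geom*xOver1mx^k k (N ∸ m))) ⟩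
  sum< (suc N) (λ m → H m * + ((N ∸ m) C k)) ∎
  where
  open ≡-Reasoning
  H = inv (comp g xOver1mx)
  P = pow xOver1mx k

centralTransform≡sum : ∀ g n →
  centralTransform g n ≡ sum< (suc n) (λ m → inv (comp g xOver1mx) m * + ((2 *ℕ n ∸ m) C n))
centralTransform≡sum g n = begin
  tnk g (2 *ℕ n) n                                   ≡⟨ tnk≡sum g (2 *ℕ n) n ⟩
  sum< (suc (2 *ℕ n)) term                           ≡⟨ cong (λ z → sum< z term) 1+2n≡[1+n]+n ⟩
  sum< (suc n +ℕ n) term                             ≡⟨ sum<-+ℕ (suc n) n term ⟩
  sum< (suc n) term + sum< n (λ i → term (suc n +ℕ i)) ≡⟨ cong (λ z → sum< (suc n) term + z) (sum<-zero n vanishes) ⟩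
  sum< (suc n) term + + 0                            ≡⟨ ℤ.+-identityʳ _ ⟩
  sum< (suc n) term                                  ∎
  where
  open ≡-Reasoning
  term : ℕ → ℤ
  term m = inv (comp g xOver1mx) m * + ((2 *ℕ n ∸ m) C n)
  1+2n≡[1+n]+n : suc (2 *ℕ n) ≡ suc n +ℕ n
  1+2n≡[1+n]+n = cong (λ z → suc (n +ℕ z)) (ℕ.+-identityʳ n)
  vanishes : ∀ {i} → i < n → term (suc n +ℕ i) ≡ + 0
  vanishes {i} i<n = trans (cong (λ z → inv (comp g xOver1mx) (suc n +ℕ i) * + z) (k>n⇒nCk≡0 small))
                           (ℤ.*-zeroʳ (inv (comp g xOver1mx) (suc n +ℕ i)))
    where
    small : 2 *ℕ n ∸ (suc n +ℕ i) < n
    small = subst (_< n) (sym 2n∸[1+n+i]≡n∸[1+i]) (ℕ.∸-monoʳ-< {n} {suc i} {0} (s≤s z≤n) i<n)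
      where
      2n∸[1+n+i]≡n∸[1+i] : 2 *ℕ n ∸ (suc n +ℕ i) ≡ n ∸ suc i
      2n∸[1+n+i]≡n∸[1+i] = begin
        (n +ℕ (n +ℕ 0)) ∸ (suc n +ℕ i)  ≡⟨ cong (λ z → (n +ℕ z) ∸ (suc n +ℕ i)) (ℕ.+-identityʳ n) ⟩
        (n +ℕ n) ∸ suc (n +ℕ i)         ≡⟨ cong ((n +ℕ n) ∸_) (ℕ.+-suc n i) ⟨
        (n +ℕ n) ∸ (n +ℕ suc i)         ≡⟨ ℕ.[m+n]∸[m+o]≡n∸o n n (suc i) ⟩
        n ∸ suc i                       ∎

comp-mul : ∀ h b y n →
  comp (mul h b) y n ≡ sum< (suc n) (λ m → h m * sum< (suc n ∸ m) (λ j → b j * pow y (m +ℕ j) n))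
comp-mul h b y n = begin
  sum< (suc n) (λ k → mul h b k * pow y k n)
    ≡⟨ sum<-ext (suc n) (λ k → *-distribʳ-sum< (suc k) (pow y k n) _) ⟩
  sum< (suc n) (λ k → sum< (suc k) (λ m → h m * b (k ∸ m) * pow y k n))
    ≡⟨ sum<-triangle (suc n) (λ m k → h m * b (k ∸ m) * pow y k n) ⟩
  sum< (suc n) (λ m → sum< (suc n ∸ m) (λ j → h m * b ((m +ℕ j) ∸ m) * pow y (m +ℕ j) n))
    ≡⟨ sum<-ext (suc n) (λ m → trans (sum<-ext (suc n ∸ m) (λ j →
          trans (cong (λ z → h m * b z * pow y (m +ℕ j) n) (ℕ.m+n∸m≡n m j)) (ℤ.*-assoc (h m) _ _)))
          (sym (*-distribˡ-sum< (suc n ∸ m) (h m) _))) ⟩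
  sum< (suc n) (λ m → h m * sum< (suc n ∸ m) (λ j → b j * pow y (m +ℕ j) n)) ∎
  where open ≡-Reasoning

Fser≗inv[g∘xOver1mx]*pow2 : ∀ g → g 0 ≡ + 1 → Fser g ≗ mul (inv (comp g xOver1mx)) pow2
Fser≗inv[g∘xOver1mx]*pow2 g g₀≡1 = begin
  inv (mul (1+cX (- + 2)) Q)         ≈⟨ inv-mul (1+cX (- + 2)) Q refl Q₀≡1 ⟩
  mul (inv (1+cX (- + 2))) (inv Q)   ≈⟨ mul-comm (inv (1+cX (- + 2))) (inv Q) ⟩
  mul (inv Q) (inv (1+cX (- + 2)))   ≈⟨ mul-congʳ (inv Q) inv[1-2X]≗pow2 ⟩
  mul (inv Q) pow2                   ∎
  where
  open ≗-Reasoning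
  Q = comp g xOver1mx
  Q₀≡1 : Q 0 ≡ + 1
  Q₀≡1 rewrite g₀≡1 = refl

-- Central binomial coefficients

[k+1]*[n+1]C[k+1]≡[n+1]*nCk : ∀ n k → suc k *ℕ (suc n C suc k) ≡ suc n *ℕ (n C k)
[k+1]*[n+1]C[k+1]≡[n+1]*nCk zero    zero    = refl
[k+1]*[n+1]C[k+1]≡[n+1]*nCk zero    (suc k)
  rewrite k>n⇒nCk≡0 {1} {suc (suc k)} (s≤s (s≤s z≤n)) | k>n⇒nCk≡0 {0} {suc k} (s≤s z≤n) =
  ℕ.*-zeroʳ (suc (suc k))
[k+1]*[n+1]C[k+1]≡[n+1]*nCk (suc n) zero    rewrite nC1≡n (suc (suc n)) =
  trans (ℕ.+-identityʳ (suc (suc n))) (sym (ℕ.*-identityʳ (suc (suc n))))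
[k+1]*[n+1]C[k+1]≡[n+1]*nCk (suc n) (suc k) = begin
  suc (suc k) *ℕ (suc (suc n) C suc (suc k))
    ≡⟨ cong (suc (suc k) *ℕ_) (nCk+nC[k+1]≡[n+1]C[k+1] (suc n) (suc k)) ⟨
  suc (suc k) *ℕ (a +ℕ b)
    ≡⟨ split-factor k a b ⟩
  suc k *ℕ a +ℕ a +ℕ suc (suc k) *ℕ b
    ≡⟨ cong₂ (λ u v → u +ℕ a +ℕ v) ([k+1]*[n+1]C[k+1]≡[n+1]*nCk n k) ([k+1]*[n+1]C[k+1]≡[n+1]*nCk n (suc k)) ⟩
  suc n *ℕ c +ℕ a +ℕ suc n *ℕ d
    ≡⟨ collect n c a d ⟩
  suc n *ℕ (c +ℕ d) +ℕ a
    ≡⟨ cong (λ z → suc n *ℕ z +ℕ a) (nCk+nC[k+1]≡[n+1]C[k+1] n k) ⟩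
  suc n *ℕ a +ℕ a
    ≡⟨ ℕ.+-comm (suc n *ℕ a) a ⟩
  suc (suc n) *ℕ a ∎
  where
  open ≡-Reasoning
  a = suc n C suc k
  b = suc n C suc (suc k)
  c = n C k
  d = n C suc k
  split-factor : ∀ k a b → suc (suc k) *ℕ (a +ℕ b) ≡ suc k *ℕ a +ℕ a +ℕ suc (suc k) *ℕ b
  split-factor = ℕ-Solver.solve-∀
  collect : ∀ n c a d → suc n *ℕ c +ℕ a +ℕ suc n *ℕ d ≡ suc n *ℕ (c +ℕ d) +ℕ a
  collect = ℕ-Solver.solve-∀

[2n+1]Cn≡[2n+1]C[n+1] : ∀ n → suc (n +ℕ n) C n ≡ suc (n +ℕ n) C suc n
[2n+1]Cn≡[2n+1]C[n+1] n =
  trans (nCk≡nC[n∸k] (ℕ.≤-trans (ℕ.m≤m+n n n) (ℕ.n≤1+n _)))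
    (cong (suc (n +ℕ n) C_) (trans (ℕ.+-∸-assoc 1 (ℕ.m≤n+m n n)) (cong suc (ℕ.m+n∸n≡m n n))))

[2n+2]C[n+1]≡2*[2n+1]C[n+1] : ∀ n → (suc n +ℕ suc n) C suc n ≡ 2 *ℕ (suc (n +ℕ n) C suc n)
[2n+2]C[n+1]≡2*[2n+1]C[n+1] n rewrite ℕ.+-suc n n = begin
  suc (suc (n +ℕ n)) C suc n                   ≡⟨ nCk+nC[k+1]≡[n+1]C[k+1] (suc (n +ℕ n)) n ⟨
  (suc (n +ℕ n) C n) +ℕ (suc (n +ℕ n) C suc n) ≡⟨ cong (_+ℕ (suc (n +ℕ n) C suc n)) ([2n+1]Cn≡[2n+1]C[n+1] n) ⟩
  a +ℕ a                                       ≡⟨ cong (a +ℕ_) (ℕ.+-identityʳ a) ⟨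
  2 *ℕ a                                       ∎
  where
  open ≡-Reasoning
  a = suc (n +ℕ n) C suc n

[n+1]*[2n+2]C[n+1]≡2*[2n+1]*[2n]Cn : ∀ n →
  suc n *ℕ ((suc n +ℕ suc n) C suc n) ≡ 2 *ℕ (suc (n +ℕ n) *ℕ ((n +ℕ n) C n))
[n+1]*[2n+2]C[n+1]≡2*[2n+1]*[2n]Cn n rewrite ℕ.+-suc n n = begin
  suc n *ℕ (suc (suc (n +ℕ n)) C suc n)        ≡⟨ [k+1]*[n+1]C[k+1]≡[n+1]*nCk (suc (n +ℕ n)) n ⟩
  suc (suc (n +ℕ n)) *ℕ (suc (n +ℕ n) C n)     ≡⟨ cong (suc (suc (n +ℕ n)) *ℕ_) ([2n+1]Cn≡[2n+1]C[n+1] n) ⟩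
  suc (suc (n +ℕ n)) *ℕ (suc (n +ℕ n) C suc n) ≡⟨ double n (suc (n +ℕ n) C suc n) ⟩
  2 *ℕ (suc n *ℕ (suc (n +ℕ n) C suc n))       ≡⟨ cong (2 *ℕ_) ([k+1]*[n+1]C[k+1]≡[n+1]*nCk (n +ℕ n) n) ⟩
  2 *ℕ (suc (n +ℕ n) *ℕ ((n +ℕ n) C n))        ∎
  where
  open ≡-Reasoning
  double : ∀ n x → suc (suc (n +ℕ n)) *ℕ x ≡ 2 *ℕ (suc n *ℕ x)
  double = ℕ-Solver.solve-∀

[n+1]*[2n]C[n+1]≡n*[2n]Cn : ∀ n → suc n *ℕ ((n +ℕ n) C suc n) ≡ n *ℕ ((n +ℕ n) C n)
[n+1]*[2n]C[n+1]≡n*[2n]Cn zero    = refl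
[n+1]*[2n]C[n+1]≡n*[2n]Cn (suc n) rewrite ℕ.+-suc n n = begin
  suc (suc n) *ℕ (suc (suc (n +ℕ n)) C suc (suc n)) ≡⟨ [k+1]*[n+1]C[k+1]≡[n+1]*nCk (suc (n +ℕ n)) (suc n) ⟩
  suc (suc (n +ℕ n)) *ℕ (suc (n +ℕ n) C suc n)      ≡⟨ cong (suc (suc (n +ℕ n)) *ℕ_) ([2n+1]Cn≡[2n+1]C[n+1] n) ⟨
  suc (suc (n +ℕ n)) *ℕ (suc (n +ℕ n) C n)          ≡⟨ [k+1]*[n+1]C[k+1]≡[n+1]*nCk (suc (n +ℕ n)) n ⟨
  suc n *ℕ (suc (suc (n +ℕ n)) C suc n)             ∎
  where open ≡-Reasoning

-- The Catalan number is the difference C(2n,n) - C(2n,n+1), which makes its division exact.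
[n+1]*catalan≡[2n]Cn : ∀ n → suc n *ℕ (((2 *ℕ n) C n) / suc n) ≡ (n +ℕ n) C n
[n+1]*catalan≡[2n]Cn n = begin
  suc n *ℕ (((2 *ℕ n) C n) / suc n)    ≡⟨ cong (λ z → suc n *ℕ ((z C n) / suc n)) (cong (n +ℕ_) (ℕ.+-identityʳ n)) ⟩
  suc n *ℕ (c₀ / suc n)                ≡⟨ cong (λ z → suc n *ℕ (z / suc n)) catalan*[n+1] ⟨
  suc n *ℕ ((c₀ ∸ c₁) *ℕ suc n / suc n) ≡⟨ cong (suc n *ℕ_) (m*n/n≡m (c₀ ∸ c₁) (suc n)) ⟩
  suc n *ℕ (c₀ ∸ c₁)                   ≡⟨ ℕ.*-comm (suc n) (c₀ ∸ c₁) ⟩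
  (c₀ ∸ c₁) *ℕ suc n                   ≡⟨ catalan*[n+1] ⟩
  c₀                                   ∎
  where
  open ≡-Reasoning
  c₀ = (n +ℕ n) C n
  c₁ = (n +ℕ n) C suc n
  catalan*[n+1] : (c₀ ∸ c₁) *ℕ suc n ≡ c₀
  catalan*[n+1] = begin
    (c₀ ∸ c₁) *ℕ suc n               ≡⟨ ℕ.*-distribʳ-∸ (suc n) c₀ c₁ ⟩
    c₀ *ℕ suc n ∸ c₁ *ℕ suc n        ≡⟨ cong₂ _∸_ (ℕ.*-comm c₀ (suc n))
                                          (trans (ℕ.*-comm c₁ (suc n)) ([n+1]*[2n]C[n+1]≡n*[2n]Cn n)) ⟩
    (c₀ +ℕ n *ℕ c₀) ∸ n *ℕ c₀        ≡⟨ ℕ.m+n∸n≡m c₀ (n *ℕ c₀) ⟩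
    c₀                               ∎

-- Derivatives and the Catalan series

deriv : Series → Series
deriv f n = + suc n * f (suc n)

deriv-injective : ∀ f g → deriv f ≗ deriv g → f 0 ≡ g 0 → f ≗ g
deriv-injective f g f′≗g′ f₀≡g₀ zero    = f₀≡g₀
deriv-injective f g f′≗g′ f₀≡g₀ (suc n) = ℤ.*-cancelˡ-≡ (+ suc n) (f (suc n)) (g (suc n)) (f′≗g′ n)

deriv-⊕ : ∀ f g → deriv (f ⊕ g) ≗ (deriv f ⊕ deriv g)
deriv-⊕ f g n = ℤ.*-distribˡ-+ (+ suc n) (f (suc n)) (g (suc n))

deriv-X : deriv X ≗ oneS
deriv-X zero    = refl
deriv-X (suc n) = ℤ.*-zeroʳ (+ suc (suc n))

deriv-1+cX : ∀ c → deriv (1+cX c) ≗ scale c oneS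
deriv-1+cX c zero    = coefficient c
  where
  coefficient : ∀ (c : ℤ) → + 1 * (+ 0 + c * + 1) ≡ c * + 1
  coefficient = solve-∀
deriv-1+cX c (suc n) = trans (cong (λ z → + suc (suc n) * (+ 0 + z)) (ℤ.*-zeroʳ c)) (trans (ℤ.*-zeroʳ (+ suc (suc n))) (sym (ℤ.*-zeroʳ c)))

deriv-mul : ∀ f g → deriv (mul f g) ≗ (mul (deriv f) g ⊕ mul f (deriv g))
deriv-mul f g n = begin
  + suc n * sum< (suc (suc n)) (λ i → f i * g (suc n ∸ i))
    ≡⟨ *-distribˡ-sum< (suc (suc n)) (+ suc n) _ ⟩
  sum< (suc (suc n)) (λ i → + suc n * (f i * g (suc n ∸ i)))
    ≡⟨ sum<-cong (suc (suc n)) split-degree ⟩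
  sum< (suc (suc n)) (λ i → dfg i + fdg i)
    ≡⟨ sum<-distrib-+ (suc (suc n)) dfg fdg ⟩
  sum< (suc (suc n)) dfg + sum< (suc (suc n)) fdg
    ≡⟨ cong₂ _+_ drop-first drop-last ⟩
  mul (deriv f) g n + mul f (deriv g) n ∎
  where
  open ≡-Reasoning
  dfg fdg : ℕ → ℤ
  dfg i = (+ i * f i) * g (suc n ∸ i)
  fdg i = f i * (+ (suc n ∸ i) * g (suc n ∸ i))
  distribute : ∀ (a b x y : ℤ) → (a + b) * (x * y) ≡ (a * x) * y + x * (b * y)
  distribute = solve-∀
  split-degree : ∀ {i} → i < suc (suc n) → + suc n * (f i * g (suc n ∸ i)) ≡ dfg i + fdg i
  split-degree {i} (s≤s i≤1+n) =
    trans (cong (λ z → z * (f i * g (suc n ∸ i))) (trans (cong +_ (sym (ℕ.m+[n∸m]≡n i≤1+n))) (ℤ.pos-+ i (suc n ∸ i))))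
          (distribute (+ i) (+ (suc n ∸ i)) (f i) (g (suc n ∸ i)))
  drop-first : sum< (suc (suc n)) dfg ≡ mul (deriv f) g n
  drop-first = begin
    sum< (suc (suc n)) dfg              ≡⟨ sum<-suc-head (suc n) dfg ⟩
    + 0 * f 0 * g (suc n) + mul (deriv f) g n
      ≡⟨ cong (_+ mul (deriv f) g n) (trans (cong (_* g (suc n)) (ℤ.*-zeroˡ (f 0))) (ℤ.*-zeroˡ (g (suc n)))) ⟩
    + 0 + mul (deriv f) g n             ≡⟨ ℤ.+-identityˡ _ ⟩
    mul (deriv f) g n                   ∎
  drop-last : sum< (suc (suc n)) fdg ≡ mul f (deriv g) n
  drop-last = begin
    sum< (suc n) fdg + fdg (suc n)      ≡⟨ cong (λ z → sum< (suc n) fdg + z) last-vanishes ⟩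
    sum< (suc n) fdg + + 0              ≡⟨ ℤ.+-identityʳ _ ⟩
    sum< (suc n) fdg                    ≡⟨ sum<-cong (suc n) reindex ⟩
    mul f (deriv g) n                   ∎
    where
    last-vanishes : fdg (suc n) ≡ + 0
    last-vanishes rewrite ℕ.n∸n≡0 n = trans (cong (f (suc n) *_) (ℤ.*-zeroˡ (g 0))) (ℤ.*-zeroʳ (f (suc n)))
    reindex : ∀ {i} → i < suc n → fdg i ≡ f i * deriv g (n ∸ i)
    reindex {i} (s≤s i≤n) rewrite ℕ.+-∸-assoc 1 i≤n = refl

centralBinom : Series
centralBinom n = + ((n +ℕ n) C n)

xc-zero : xc 0 ≡ + 0
xc-zero = mul-Xˡ catalanS 0

xc-suc : ∀ n → xc (suc n) ≡ catalanS n
xc-suc n = mul-Xˡ catalanS (suc n)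

deriv-xc : deriv xc ≗ centralBinom
deriv-xc n = begin
  + suc n * xc (suc n)                          ≡⟨ cong (+ suc n *_) (xc-suc n) ⟩
  + suc n * + (((2 *ℕ n) C n) / suc n)          ≡⟨ ℤ.pos-* (suc n) _ ⟨
  + (suc n *ℕ (((2 *ℕ n) C n) / suc n))         ≡⟨ cong +_ ([n+1]*catalan≡[2n]Cn n) ⟩
  centralBinom n                                ∎
  where open ≡-Reasoning

[n+1]*centralBinom[n+1] : ∀ n → + suc n * centralBinom (suc n) ≡ + 2 * ((+ n + + n + + 1) * centralBinom n)
[n+1]*centralBinom[n+1] n = begin
  + suc n * centralBinom (suc n)                   ≡⟨ ℤ.pos-* (suc n) _ ⟨
  + (suc n *ℕ ((suc n +ℕ suc n) C suc n))          ≡⟨ cong +_ ([n+1]*[2n+2]C[n+1]≡2*[2n+1]*[2n]Cn n) ⟩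
  + (2 *ℕ (suc (n +ℕ n) *ℕ ((n +ℕ n) C n)))        ≡⟨ ℤ.pos-* 2 (suc (n +ℕ n) *ℕ ((n +ℕ n) C n)) ⟩
  + 2 * + (suc (n +ℕ n) *ℕ ((n +ℕ n) C n))         ≡⟨ cong (+ 2 *_) (ℤ.pos-* (suc (n +ℕ n)) _) ⟩
  + 2 * (+ suc (n +ℕ n) * centralBinom n)          ≡⟨ cong (λ z → + 2 * (z * centralBinom n)) 2n+1≡n+n+1 ⟩
  + 2 * ((+ n + + n + + 1) * centralBinom n)       ∎
  where
  open ≡-Reasoning
  2n+1≡n+n+1 : + suc (n +ℕ n) ≡ + n + + n + + 1
  2n+1≡n+n+1 = trans (cong +_ (ℕ.+-comm 1 (n +ℕ n))) (trans (ℤ.pos-+ (n +ℕ n) 1) (cong (_+ + 1) (ℤ.pos-+ n n)))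

[1-4X]*deriv-centralBinom : mul (1+cX (- + 4)) (deriv centralBinom) ≗ scale (+ 2) centralBinom
[1-4X]*deriv-centralBinom n = trans (mul-1+cX (- + 4) (deriv centralBinom) n) (coefficient n)
  where
  collect : ∀ (b k : ℤ) → + 2 * ((k + k + + 1) * b) + (- + 4) * (k * b) ≡ + 2 * b
  collect = solve-∀
  coefficient : (deriv centralBinom ⊕ scale (- + 4) (shift (deriv centralBinom))) ≗ scale (+ 2) centralBinom
  coefficient zero    = refl
  coefficient (suc n) =
    trans (cong (_+ (- + 4) * (+ suc n * centralBinom (suc n))) ([n+1]*centralBinom[n+1] (suc n)))
          (collect (centralBinom (suc n)) (+ suc n))

1-2xc≗[1-4X]*centralBinom : (oneS ⊕ scale (- + 2) xc) ≗ mul (1+cX (- + 4)) centralBinom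
1-2xc≗[1-4X]*centralBinom n = sym (trans (mul-1+cX (- + 4) centralBinom n) (coefficient n))
  where
  coefficient : (centralBinom ⊕ scale (- + 4) (shift centralBinom)) ≗ (oneS ⊕ scale (- + 2) xc)
  coefficient zero    = refl
  coefficient (suc n) = ℤ.*-cancelˡ-≡ (+ suc n) _ _ (trans left (sym right))
    where
    open ≡-Reasoning
    collect : ∀ (b k : ℤ) → + 2 * ((k + k + + 1) * b) + (+ 1 + k) * ((- + 4) * b) ≡ (- + 2) * b
    collect = solve-∀
    pull : ∀ (s c : ℤ) → s * (+ 0 + (- + 2) * c) ≡ (- + 2) * (s * c)
    pull = solve-∀
    b = centralBinom n
    left : + suc n * (centralBinom (suc n) + (- + 4) * b) ≡ (- + 2) * b
    left = begin
      + suc n * (centralBinom (suc n) + (- + 4) * b)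
        ≡⟨ ℤ.*-distribˡ-+ (+ suc n) (centralBinom (suc n)) ((- + 4) * b) ⟩
      + suc n * centralBinom (suc n) + + suc n * ((- + 4) * b)
        ≡⟨ cong₂ _+_ ([n+1]*centralBinom[n+1] n) (cong (_* ((- + 4) * b)) (ℤ.pos-+ 1 n)) ⟩
      + 2 * ((+ n + + n + + 1) * b) + (+ 1 + + n) * ((- + 4) * b)
        ≡⟨ collect b (+ n) ⟩
      (- + 2) * b ∎
    right : + suc n * (+ 0 + (- + 2) * xc (suc n)) ≡ (- + 2) * b
    right = trans (pull (+ suc n) (xc (suc n))) (cong ((- + 2) *_) (deriv-xc n))

-- With B = centralBinom, B (1 - 4x) B has derivative 2B² + B(-4B + 2B) = 0, using (1 - 4x) B′ = 2B.
centralBinom*[1-2xc]≗1 : mul centralBinom (oneS ⊕ scale (- + 2) xc) ≗ oneS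
centralBinom*[1-2xc]≗1 = begin
  mul B (oneS ⊕ scale (- + 2) xc)  ≈⟨ mul-congʳ B 1-2xc≗[1-4X]*centralBinom ⟩
  mul B (mul T B)                  ≈⟨ deriv-injective (mul B (mul T B)) oneS derivatives-agree refl ⟩
  oneS                             ∎
  where
  open ≗-Reasoning
  B = centralBinom
  T = 1+cX (- + 4)
  B′*TB : mul (deriv B) (mul T B) ≗ scale (+ 2) (mul B B)
  B′*TB = begin
    mul (deriv B) (mul T B)    ≈⟨ mul-comm (deriv B) (mul T B) ⟩
    mul (mul T B) (deriv B)    ≈⟨ mul-assoc T B (deriv B) ⟩
    mul T (mul B (deriv B))    ≈⟨ mul-congʳ T (mul-comm B (deriv B)) ⟩
    mul T (mul (deriv B) B)    ≈⟨ mul-assoc T (deriv B) B ⟨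
    mul (mul T (deriv B)) B    ≈⟨ mul-congˡ B [1-4X]*deriv-centralBinom ⟩
    mul (scale (+ 2) B) B      ≈⟨ mul-scaleˡ (+ 2) B B ⟩
    scale (+ 2) (mul B B)      ∎
  T′B : mul (deriv T) B ≗ scale (- + 4) B
  T′B = begin
    mul (deriv T) B            ≈⟨ mul-congˡ B (deriv-1+cX (- + 4)) ⟩
    mul (scale (- + 4) oneS) B ≈⟨ mul-scaleˡ (- + 4) oneS B ⟩
    scale (- + 4) (mul oneS B) ≈⟨ (λ n → cong ((- + 4) *_) (mul-identityˡ B n)) ⟩
    scale (- + 4) B            ∎
  B*[TB]′ : mul B (deriv (mul T B)) ≗ (scale (- + 4) (mul B B) ⊕ scale (+ 2) (mul B B))
  B*[TB]′ = begin
    mul B (deriv (mul T B))                                ≈⟨ mul-congʳ B (deriv-mul T B) ⟩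
    mul B (mul (deriv T) B ⊕ mul T (deriv B))              ≈⟨ mul-congʳ B (λ n → cong₂ _+_ (T′B n) ([1-4X]*deriv-centralBinom n)) ⟩
    mul B (scale (- + 4) B ⊕ scale (+ 2) B)                ≈⟨ mul-distribˡ-⊕ B (scale (- + 4) B) (scale (+ 2) B) ⟩
    (mul B (scale (- + 4) B) ⊕ mul B (scale (+ 2) B))      ≈⟨ (λ n → cong₂ _+_ (mul-scaleʳ B (- + 4) B n) (mul-scaleʳ B (+ 2) B n)) ⟩
    (scale (- + 4) (mul B B) ⊕ scale (+ 2) (mul B B))      ∎
  cancel : ∀ (x : ℤ) → + 2 * x + ((- + 4) * x + + 2 * x) ≡ + 0
  cancel = solve-∀
  derivatives-agree : deriv (mul B (mul T B)) ≗ deriv oneS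
  derivatives-agree n =
    trans (deriv-mul B (mul T B) n)
      (trans (cong₂ _+_ (B′*TB n) (B*[TB]′ n)) (trans (cancel (mul B B n)) (sym (ℤ.*-zeroʳ (+ suc n)))))

centralBinom-2*centralBinom*xc : ∀ n → centralBinom n + (- + 2) * mul centralBinom xc n ≡ oneS n
centralBinom-2*centralBinom*xc n = begin
  centralBinom n + (- + 2) * mul centralBinom xc n
    ≡⟨ cong₂ _+_ (mul-identityʳ centralBinom n) (mul-scaleʳ centralBinom (- + 2) xc n) ⟨
  mul centralBinom oneS n + mul centralBinom (scale (- + 2) xc) n
    ≡⟨ mul-distribˡ-⊕ centralBinom oneS (scale (- + 2) xc) n ⟨
  mul centralBinom (oneS ⊕ scale (- + 2) xc) n
    ≡⟨ centralBinom*[1-2xc]≗1 n ⟩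
  oneS n ∎
  where open ≡-Reasoning

-- xc² + x and xc vanish at 0 and both have derivative B, because 2 B xc + 1 = B.
xc²≗xc-X : mul xc xc ≗ (xc ⊕ scale (- + 1) X)
xc²≗xc-X n = trans (move (mul xc xc n) (X n)) (cong (_+ (- + 1) * X n) (xc²+X≗xc n))
  where
  open ≡-Reasoning
  move : ∀ (a b : ℤ) → a ≡ a + b + (- + 1) * b
  move = solve-∀
  regroup : ∀ (b m o : ℤ) → m + m + o ≡ b + (- + 1) * (b + (- + 2) * m + (- + 1) * o)
  regroup = solve-∀
  cancel : ∀ (b o : ℤ) → b + (- + 1) * (o + (- + 1) * o) ≡ b
  cancel = solve-∀
  derivatives-agree : deriv (mul xc xc ⊕ X) ≗ deriv xc
  derivatives-agree n = begin
    deriv (mul xc xc ⊕ X) n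
      ≡⟨ deriv-⊕ (mul xc xc) X n ⟩
    deriv (mul xc xc) n + deriv X n
      ≡⟨ cong₂ _+_ (deriv-mul xc xc n) (deriv-X n) ⟩
    mul (deriv xc) xc n + mul xc (deriv xc) n + oneS n
      ≡⟨ cong (_+ oneS n) (cong₂ _+_ (mul-congˡ xc deriv-xc n)
                                      (trans (mul-congʳ xc deriv-xc n) (mul-comm xc centralBinom n))) ⟩
    m + m + oneS n
      ≡⟨ regroup (centralBinom n) m (oneS n) ⟩
    centralBinom n + (- + 1) * (centralBinom n + (- + 2) * m + (- + 1) * oneS n)
      ≡⟨ cong (λ z → centralBinom n + (- + 1) * (z + (- + 1) * oneS n)) (centralBinom-2*centralBinom*xc n) ⟩
    centralBinom n + (- + 1) * (oneS n + (- + 1) * oneS n)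
      ≡⟨ cancel (centralBinom n) (oneS n) ⟩
    centralBinom n
      ≡⟨ deriv-xc n ⟨
    deriv xc n ∎
    where m = mul centralBinom xc n
  xc²+X≗xc : (mul xc xc ⊕ X) ≗ xc
  xc²+X≗xc = deriv-injective (mul xc xc ⊕ X) xc derivatives-agree refl

-- Powers of x c(x)

pow-vanishes : ∀ y → y 0 ≡ + 0 → ∀ m {i} → i < m → pow y m i ≡ + 0
pow-vanishes y y₀≡0 (suc m) {i} i<1+m = sum<-zero (suc i) term-vanishes
  where
  term-vanishes : ∀ {j} → j < suc i → y j * pow y m (i ∸ j) ≡ + 0
  term-vanishes {zero}  _ = trans (cong (_* pow y m i) y₀≡0) (ℤ.*-zeroˡ (pow y m i))
  term-vanishes {suc j} (s≤s j<i) =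
    trans (cong (y (suc j) *_) (pow-vanishes y y₀≡0 m (ℕ.<-≤-trans (ℕ.∸-monoʳ-< {i} {suc j} {0} (s≤s z≤n) j<i) (ℕ.≤-pred i<1+m))))
          (ℤ.*-zeroʳ (y (suc j)))

xc^[_]*B : ℕ → Series
xc^[ m ]*B = mul (pow xc m) centralBinom

xc^[m]*B-vanishes : ∀ m {n} → n < m → xc^[ m ]*B n ≡ + 0
xc^[m]*B-vanishes m {n} n<m = sum<-zero (suc n) (λ {i} i<1+n →
  trans (cong (_* centralBinom (n ∸ i)) (pow-vanishes xc xc-zero m (ℕ.≤-<-trans (ℕ.≤-pred i<1+n) n<m)))
        (ℤ.*-zeroˡ (centralBinom (n ∸ i))))

xc^m≡xc^[m]*B-2xc^[1+m]*B : ∀ m n → pow xc m n ≡ xc^[ m ]*B n + (- + 2) * xc^[ suc m ]*B n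
xc^m≡xc^[m]*B-2xc^[1+m]*B m n = begin
  P n                                                ≡⟨ mul-identityʳ P n ⟨
  mul P oneS n                                       ≡⟨ mul-congʳ P centralBinom*[1-2xc]≗1 n ⟨
  mul P (mul centralBinom (oneS ⊕ scale (- + 2) xc)) n
    ≡⟨ mul-congʳ P (λ k → trans (mul-distribˡ-⊕ centralBinom oneS (scale (- + 2) xc) k)
                                (cong₂ _+_ (mul-identityʳ centralBinom k) (mul-scaleʳ centralBinom (- + 2) xc k))) n ⟩
  mul P (centralBinom ⊕ scale (- + 2) (mul centralBinom xc)) n
    ≡⟨ mul-distribˡ-⊕ P centralBinom (scale (- + 2) (mul centralBinom xc)) n ⟩
  xc^[ m ]*B n + mul P (scale (- + 2) (mul centralBinom xc)) n
    ≡⟨ cong (λ z → xc^[ m ]*B n + z) (mul-scaleʳ P (- + 2) (mul centralBinom xc) n) ⟩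
  xc^[ m ]*B n + (- + 2) * mul P (mul centralBinom xc) n
    ≡⟨ cong (λ z → xc^[ m ]*B n + (- + 2) * z) (absorb n) ⟩
  xc^[ m ]*B n + (- + 2) * xc^[ suc m ]*B n ∎
  where
  open ≡-Reasoning
  P = pow xc m
  absorb : mul P (mul centralBinom xc) ≗ xc^[ suc m ]*B
  absorb k = begin
    mul P (mul centralBinom xc) k   ≡⟨ mul-congʳ P (mul-comm centralBinom xc) k ⟩
    mul P (mul xc centralBinom) k   ≡⟨ mul-assoc P xc centralBinom k ⟨
    mul (mul P xc) centralBinom k   ≡⟨ mul-congˡ centralBinom (mul-comm P xc) k ⟩
    mul (mul xc P) centralBinom k   ∎

xc^[2+m]*B-recurrence : ∀ m n → xc^[ suc (suc m) ]*B (suc n) ≡ xc^[ suc m ]*B (suc n) + (- + 1) * xc^[ m ]*B n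
xc^[2+m]*B-recurrence m n = begin
  mul (mul xc (mul xc P)) B (suc n)
    ≡⟨ mul-congˡ B xc²P≗xcP-XP (suc n) ⟩
  mul (mul xc P ⊕ scale (- + 1) (mul X P)) B (suc n)
    ≡⟨ mul-distribʳ-⊕ B (mul xc P) (scale (- + 1) (mul X P)) (suc n) ⟩
  xc^[ suc m ]*B (suc n) + mul (scale (- + 1) (mul X P)) B (suc n)
    ≡⟨ cong (λ z → xc^[ suc m ]*B (suc n) + z) (mul-scaleˡ (- + 1) (mul X P) B (suc n)) ⟩
  xc^[ suc m ]*B (suc n) + (- + 1) * mul (mul X P) B (suc n)
    ≡⟨ cong (λ z → xc^[ suc m ]*B (suc n) + (- + 1) * z) (trans (mul-assoc X P B (suc n)) (mul-Xˡ (xc^[ m ]*B) (suc n))) ⟩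
  xc^[ suc m ]*B (suc n) + (- + 1) * xc^[ m ]*B n ∎
  where
  open ≡-Reasoning
  P = pow xc m
  B = centralBinom
  xc²P≗xcP-XP : mul xc (mul xc P) ≗ (mul xc P ⊕ scale (- + 1) (mul X P))
  xc²P≗xcP-XP k = begin
    mul xc (mul xc P) k                           ≡⟨ mul-assoc xc xc P k ⟨
    mul (mul xc xc) P k                           ≡⟨ mul-congˡ P xc²≗xc-X k ⟩
    mul (xc ⊕ scale (- + 1) X) P k                ≡⟨ mul-distribʳ-⊕ P xc (scale (- + 1) X) k ⟩
    mul xc P k + mul (scale (- + 1) X) P k        ≡⟨ cong (λ z → mul xc P k + z) (mul-scaleˡ (- + 1) X P k) ⟩
    mul xc P k + (- + 1) * mul X P k              ∎

2*xc^[1]*B≡B : ∀ n → + 2 * xc^[ 1 ]*B (suc n) ≡ centralBinom (suc n)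
2*xc^[1]*B≡B n = begin
  + 2 * xc^[ 1 ]*B (suc n)
    ≡⟨ cong (+ 2 *_) (trans (mul-congˡ B (mul-identityʳ xc) (suc n)) (mul-comm xc B (suc n))) ⟩
  + 2 * w
    ≡⟨ rearrange (B (suc n)) w ⟩
  B (suc n) + (- + 1) * (B (suc n) + (- + 2) * w)
    ≡⟨ cong (λ z → B (suc n) + (- + 1) * z) (centralBinom-2*centralBinom*xc (suc n)) ⟩
  B (suc n) + (- + 1) * + 0
    ≡⟨ ℤ.+-identityʳ (B (suc n)) ⟩
  B (suc n) ∎
  where
  open ≡-Reasoning
  B = centralBinom
  w = mul B xc (suc n)
  rearrange : ∀ (b w : ℤ) → + 2 * w ≡ b + (- + 1) * (b + (- + 2) * w)
  rearrange = solve-∀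

xc^[m]*B-closed-form : ∀ m r → xc^[ m ]*B (m +ℕ r) ≡ + ((m +ℕ (r +ℕ r)) C (m +ℕ r))
xc^[m]*B-closed-form zero          r       = mul-identityˡ centralBinom r
xc^[m]*B-closed-form (suc zero)    zero    = ℤ.*-cancelˡ-≡ (+ 2) (xc^[ 1 ]*B 1) (+ 1) (2*xc^[1]*B≡B 0)
xc^[m]*B-closed-form (suc zero)    (suc r) = ℤ.*-cancelˡ-≡ (+ 2) (xc^[ 1 ]*B (suc (suc r))) _
  (trans (2*xc^[1]*B≡B (suc r))
         (trans (cong +_ ([2n+2]C[n+1]≡2*[2n+1]C[n+1] (suc r))) (ℤ.pos-* 2 (suc (suc r +ℕ suc r) C suc (suc r)))))
xc^[m]*B-closed-form (suc (suc m)) r       = begin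
  xc^[ suc (suc m) ]*B (suc b)                          ≡⟨ xc^[2+m]*B-recurrence m b ⟩
  xc^[ suc m ]*B (suc b) + (- + 1) * xc^[ m ]*B b      ≡⟨ cong₂ (λ x y → x + (- + 1) * y) (reindex₁ (xc^[m]*B-closed-form (suc m) (suc r)))
                                                                    (reindex₀ (xc^[m]*B-closed-form m (suc r))) ⟩
  + (suc a C suc b) + (- + 1) * + (a C b)              ≡⟨ cong (λ z → + z + (- + 1) * + (a C b)) (nCk+nC[k+1]≡[n+1]C[k+1] a b) ⟨
  + ((a C b) +ℕ (a C suc b)) + (- + 1) * + (a C b)     ≡⟨ cong (_+ (- + 1) * + (a C b)) (ℤ.pos-+ (a C b) (a C suc b)) ⟩
  + (a C b) + + (a C suc b) + (- + 1) * + (a C b)      ≡⟨ cancel (+ (a C b)) (+ (a C suc b)) ⟩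
  + (a C suc b)                                        ∎
  where
  open ≡-Reasoning
  a = suc (suc (m +ℕ (r +ℕ r)))
  b = suc (m +ℕ r)
  m+[1+r]≡b : m +ℕ suc r ≡ b
  m+[1+r]≡b = ℕ.+-suc m r
  m+[2+2r]≡a : m +ℕ (suc r +ℕ suc r) ≡ a
  m+[2+2r]≡a = shift-suc m r
    where
    shift-suc : ∀ m r → m +ℕ (suc r +ℕ suc r) ≡ suc (suc (m +ℕ (r +ℕ r)))
    shift-suc = ℕ-Solver.solve-∀
  reindex₁ : xc^[ suc m ]*B (suc m +ℕ suc r) ≡ + ((suc m +ℕ (suc r +ℕ suc r)) C (suc m +ℕ suc r)) →
             xc^[ suc m ]*B (suc b) ≡ + (suc a C suc b)
  reindex₁ = subst₂ (λ i j → xc^[ suc m ]*B (suc i) ≡ + (suc j C suc i)) m+[1+r]≡b m+[2+2r]≡a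
  reindex₀ : xc^[ m ]*B (m +ℕ suc r) ≡ + ((m +ℕ (suc r +ℕ suc r)) C (m +ℕ suc r)) → xc^[ m ]*B b ≡ + (a C b)
  reindex₀ = subst₂ (λ i j → xc^[ m ]*B i ≡ + (j C i)) m+[1+r]≡b m+[2+2r]≡a
  cancel : ∀ (x y : ℤ) → x + y + (- + 1) * x ≡ y
  cancel = solve-∀

-- The splitting xc^m = xc^[m]*B - 2 xc^[m+1]*B makes the sum telescope; the remaining term
-- vanishes because its index exceeds n.
pow2*xc^-sum : ∀ n L m → m +ℕ L ≡ suc n → sum< L (λ j → pow2 j * pow xc (m +ℕ j) n) ≡ xc^[ m ]*B n
pow2*xc^-sum n zero    m m+0≡1+n =
  sym (xc^[m]*B-vanishes m (subst (n <_) (trans (sym m+0≡1+n) (ℕ.+-identityʳ m)) (ℕ.n<1+n n)))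
pow2*xc^-sum n (suc L) m m+[1+L]≡1+n = begin
  sum< (suc L) (λ j → pow2 j * pow xc (m +ℕ j) n)
    ≡⟨ sum<-suc-head L _ ⟩
  + 1 * pow xc (m +ℕ 0) n + sum< L (λ j → + 2 * pow2 j * pow xc (m +ℕ suc j) n)
    ≡⟨ cong₂ _+_ (trans (ℤ.*-identityˡ _) (cong (λ z → pow xc z n) (ℕ.+-identityʳ m))) factor-2 ⟩
  pow xc m n + + 2 * sum< L (λ j → pow2 j * pow xc (suc m +ℕ j) n)
    ≡⟨ cong₂ (λ x y → x + + 2 * y) (xc^m≡xc^[m]*B-2xc^[1+m]*B m n)
             (pow2*xc^-sum n L (suc m) (trans (sym (ℕ.+-suc m L)) m+[1+L]≡1+n)) ⟩
  xc^[ m ]*B n + (- + 2) * xc^[ suc m ]*B n + + 2 * xc^[ suc m ]*B n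
    ≡⟨ cancel (xc^[ m ]*B n) (xc^[ suc m ]*B n) ⟩
  xc^[ m ]*B n ∎
  where
  open ≡-Reasoning
  cancel : ∀ (a b : ℤ) → a + (- + 2) * b + + 2 * b ≡ a
  cancel = solve-∀
  factor-2 : sum< L (λ j → + 2 * pow2 j * pow xc (m +ℕ suc j) n) ≡ + 2 * sum< L (λ j → pow2 j * pow xc (suc m +ℕ j) n)
  factor-2 = trans (sum<-ext L (λ j → trans (ℤ.*-assoc (+ 2) (pow2 j) _) (cong (λ z → + 2 * (pow2 j * pow xc z n)) (ℕ.+-suc m j))))
                   (sym (*-distribˡ-sum< L (+ 2) _))

pow2*xc^-sum≡binomial : ∀ n {m} → m ≤ n → sum< (suc n ∸ m) (λ j → pow2 j * pow xc (m +ℕ j) n) ≡ + ((2 *ℕ n ∸ m) C n)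
pow2*xc^-sum≡binomial n {m} m≤n = begin
  sum< (suc n ∸ m) (λ j → pow2 j * pow xc (m +ℕ j) n)
    ≡⟨ pow2*xc^-sum n (suc n ∸ m) m (ℕ.m+[n∸m]≡n (ℕ.m≤n⇒m≤1+n m≤n)) ⟩
  xc^[ m ]*B n
    ≡⟨ subst (λ n → xc^[ m ]*B n ≡ + ((2 *ℕ n ∸ m) C n)) (ℕ.m+[n∸m]≡n m≤n) (closed-form (n ∸ m)) ⟩
  + ((2 *ℕ n ∸ m) C n) ∎
  where
  open ≡-Reasoning
  2[m+r]≡m+[m+[r+r]] : ∀ m r → 2 *ℕ (m +ℕ r) ≡ m +ℕ (m +ℕ (r +ℕ r))
  2[m+r]≡m+[m+[r+r]] = ℕ-Solver.solve-∀
  closed-form : ∀ r → xc^[ m ]*B (m +ℕ r) ≡ + ((2 *ℕ (m +ℕ r) ∸ m) C (m +ℕ r))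
  closed-form r = trans (xc^[m]*B-closed-form m r)
    (cong (λ z → + (z C (m +ℕ r))) (sym (trans (cong (_∸ m) (2[m+r]≡m+[m+[r+r]] m r)) (ℕ.m+n∸m≡n m _))))

mainTheorem5 : (g : Series) → g 0 ≡ + 1 →
    (n : ℕ) → centralTransform g n ≡ comp (Fser g) xc n
mainTheorem5 g g₀≡1 n = begin
  centralTransform g n
    ≡⟨ centralTransform≡sum g n ⟩
  sum< (suc n) (λ m → H m * + ((2 *ℕ n ∸ m) C n))
    ≡⟨ sum<-cong (suc n) (λ {m} m<1+n → cong (H m *_) (pow2*xc^-sum≡binomial n (ℕ.≤-pred m<1+n))) ⟨
  sum< (suc n) (λ m → H m * sum< (suc n ∸ m) (λ j → pow2 j * pow xc (m +ℕ j) n))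
    ≡⟨ comp-mul H pow2 xc n ⟨
  comp (mul H pow2) xc n
    ≡⟨ sum<-ext (suc n) (λ k → cong (_* pow xc k n) (Fser≗inv[g∘xOver1mx]*pow2 g g₀≡1 k)) ⟨
  comp (Fser g) xc n ∎
  where
  open ≡-Reasoning
  H = inv (comp g xOver1mx)
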